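{- Let $v\geq 1$ and, for $i=1,\dots,v$, let $A_i=\begin{bmatrix}0&\epsilon_i\\ 1&\alpha_i\end{bmatrix}$ with $\epsilon_i\in\{ -1,1\}$, $\alpha_i\in\mathbb{Z}$. Let $P_1,P_2$ be finite words in $A_1,\dots,A_v$ satisfying the conditions in the context, let $(q_m)_{m\ge1}$ be positive integers, and define $P_{m+2}=P_{m+1}^{q_m}P_m=\begin{bmatrix}a_{m+2}&b_{m+2}\\ c_{m+2}&d_{m+2}\end{bmatrix}$ for $m\ge1$. Suppose it is not the case that $|b_m|=|c_m|=|d_m|-1=|a_m|+1$ holds for all sufficiently large $m$. Then $\lim_{m\to\infty}\frac{a_m}{c_m}$ exists, lies between $-1$ and $1$, and is irrational.
   Context: Conditions on $P_1,P_2$: writing $P_i=\begin{bmatrix}a_i&b_i\\ c_i&d_i\end{bmatrix}$ for the matrix product of the word, $|d_i|\ge2$, $b_i\ne0$, $c_i\ne0$ and $0\le\frac{|a_i|}{|b_i|},\frac{|c_i|}{|d_i|},\frac{|a_i|}{|c_i|},\frac{|b_i|}{|d_i|}\le1$ for $i=1,2$. -}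

module Defs where

open import Data.Nat as ℕ using (ℕ; zero; suc)
open import Data.Integer as ℤ using (ℤ; +_; -[1+_])
open import Data.Rational as ℚ using (ℚ; 0ℚ)
open import Data.Fin using (Fin)
open import Data.List using (List; []; _∷_)
open import Data.Sum using (_⊎_)
open import Relation.Binary.PropositionalEquality using (_≡_)

record Mat : Set where
  constructor mat
  field
    a b c d : ℤ
open Mat public

infixl 7 _⊗_
_⊗_ : Mat → Mat → Mat
mat a₁ b₁ c₁ d₁ ⊗ mat a₂ b₂ c₂ d₂ =
  mat (a₁ ℤ.* a₂ ℤ.+ b₁ ℤ.* c₂) (a₁ ℤ.* b₂ ℤ.+ b₁ ℤ.* d₂)
      (c₁ ℤ.* a₂ ℤ.+ d₁ ℤ.* c₂) (c₁ ℤ.* b₂ ℤ.+ d₁ ℤ.* d₂)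

I₂ : Mat
I₂ = mat (+ 1) (+ 0) (+ 0) (+ 1)

_^ᴹ_ : Mat → ℕ → Mat
M ^ᴹ zero = I₂
M ^ᴹ suc n = M ⊗ (M ^ᴹ n)

Agen : ℤ → ℤ → Mat
Agen ε α = mat (+ 0) ε (+ 1) α

IsSign : ℤ → Set
IsSign e = (e ≡ ℤ.- (+ 1)) ⊎ (e ≡ + 1)

evalWord : ∀ {v} → (Fin v → ℤ) → (Fin v → ℤ) → List (Fin v) → Mat
evalWord ε α [] = I₂
evalWord ε α (i ∷ w) = Agen (ε i) (α i) ⊗ evalWord ε α w

-- The sequence P, shifted by one: Pseq P₁ P₂ q k = P_{k+1} of the paper, with
-- q k = q_{k+1}.  So  P_{m+2} = P_{m+1}^{q_m} P_m  becomes
-- Pseq (suc (suc k)) = Pseq (suc k) ^ q k ⊗ Pseq k.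
Pseq : Mat → Mat → (ℕ → ℕ) → ℕ → Mat
Pseq P₁ P₂ q zero = P₁
Pseq P₁ P₂ q (suc zero) = P₂
Pseq P₁ P₂ q (suc (suc k)) = (Pseq P₁ P₂ q (suc k) ^ᴹ q k) ⊗ Pseq P₁ P₂ q k

-- The conditions of the context on a matrix P = [[a,b],[c,d]]:
-- |d| ≥ 2, b ≠ 0, c ≠ 0, |a|/|b| ≤ 1, |c|/|d| ≤ 1, |a|/|c| ≤ 1, |b|/|d| ≤ 1
-- (the denominators are positive, so the ratio bounds are stated by
-- clearing denominators; 0 ≤ ratio is automatic).
Cond : Mat → Set
Cond P =
  (2 ℕ.≤ ℤ.∣ d P ∣) × ¬ (b P ≡ + 0) × ¬ (c P ≡ + 0)
  × (ℤ.∣ a P ∣ ℕ.≤ ℤ.∣ b P ∣) × (ℤ.∣ c P ∣ ℕ.≤ ℤ.∣ d P ∣)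
  × (ℤ.∣ a P ∣ ℕ.≤ ℤ.∣ c P ∣) × (ℤ.∣ b P ∣ ℕ.≤ ℤ.∣ d P ∣)
  where
    open import Data.Product using (_×_)
    open import Relation.Nullary using (¬_)

Exceptional : Mat → Set
Exceptional P =
  (ℤ.∣ b P ∣ ≡ ℤ.∣ c P ∣) × (ℤ.∣ c P ∣ ≡ ℤ.∣ d P ∣ ℕ.∸ 1)
  × (ℤ.∣ d P ∣ ℕ.∸ 1 ≡ ℤ.∣ a P ∣ ℕ.+ 1)
  where open import Data.Product using (_×_)

-- x / y as a rational number (defined as 0 when y = 0; only used where y ≠ 0)
ratio : ℤ → ℤ → ℚ
ratio x (+ zero) = 0ℚ
ratio x (+ suc n) = x ℚ./ suc n
ratio x -[1+ n ] = (ℤ.- x) ℚ./ suc n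

-- Convergence notions for rational sequences (limits taken in ℝ).
CauchySeq : (ℕ → ℚ) → Set
CauchySeq x = ∀ (ε : ℚ) → ε ℚ.> 0ℚ →
  Σ ℕ λ N → ∀ m n → N ℕ.≤ m → N ℕ.≤ n → ℚ.∣ x m ℚ.- x n ∣ ℚ.< ε
  where open import Data.Product using (Σ)

ConvergesTo : (ℕ → ℚ) → ℚ → Set
ConvergesTo x r = ∀ (ε : ℚ) → ε ℚ.> 0ℚ →
  Σ ℕ λ N → ∀ m → N ℕ.≤ m → ℚ.∣ x m ℚ.- r ∣ ℚ.< ε
  where open import Data.Product using (Σ)

LimitIn[-1,1] : (ℕ → ℚ) → Set
LimitIn[-1,1] x = ∀ (ε : ℚ) → ε ℚ.> 0ℚ →
  Σ ℕ λ N → ∀ m → N ℕ.≤ m →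
    (ℚ.- ℚ.1ℚ ℚ.- ε ℚ.≤ x m) × (x m ℚ.≤ ℚ.1ℚ ℚ.+ ε)
  where open import Data.Product using (Σ; _×_)

LimitIrrational : (ℕ → ℚ) → Set
LimitIrrational x = ∀ (r : ℚ) → ¬ ConvergesTo x r
  where open import Relation.Nullary using (¬_)

{-# OPTIONS --safe #-}

-- Call a matrix admissible if it satisfies Cond and has determinant ±1, as every word in the
-- A_i does.  An admissible M maps the cone |u| ≤ |v| into itself, acting on columns from the
-- left and on rows from the right, and this makes admissible matrices closed under products with
-- |d| strictly increasing.  Hence every P_m is admissible, |d (P_m)| → ∞, and P_{k+1} is a left
-- factor of every later P_m with admissible cofactor.  Such a factorisation M = W V gives
-- |a_M / c_M - b_W / d_W| ≤ |a_V| / (|c_M| |d_W|) ≤ 1 / |d_W|, so a_m / c_m is Cauchy, and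
-- |a| ≤ |c| keeps it in [-1, 1].  If it converged to ν / s, consider the row vector
-- (e , f) = (s , -ν) P.  Were |f| > |e| for some left factor W of infinitely many P_m, those
-- a_m / c_m would stay 1 / (s (|c_W| + |d_W|)) away from ν / s; so |f| ≤ |e|, and then
-- |e (P_m)| is positive and non-increasing, hence eventually constant.  Three equal consecutive
-- values force |b| = |c| = |d| - 1 = |a| + 1 on P_m, against the hypothesis.
module Submission where

open import Defs
open import Data.Nat using (ℕ; _≤_; _≥_)
open import Data.Integer using (ℤ; +_)
open import Data.Fin using (Fin)
open import Data.List using (List; []; _∷_)
open import Data.Product using (Σ; _×_; _,_; proj₁; proj₂)
open import Relation.Nullary using (¬_)
open import Relation.Binary.PropositionalEquality using (_≡_)

open import Data.Nat using (suc; zero; _<_; z≤n; s≤s)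
open import Data.Integer using (-[1+_]; _+_; _-_; _*_; -_; ∣_∣)
open import Data.Sum using (_⊎_; inj₁; inj₂)
open import Data.Empty using (⊥; ⊥-elim)
open import Function using (_∘_)
open import Relation.Nullary using (yes; no)
open import Relation.Binary.PropositionalEquality
  using (_≢_; refl; sym; trans; cong; cong₂; subst; subst₂; module ≡-Reasoning)
import Data.Nat as ℕ
import Data.Integer as ℤ
import Data.Nat.Properties as ℕₚ
import Data.Integer.Properties as ℤₚ
import Data.Nat.Tactic.RingSolver as ℕ-Solver
open import Data.Nat.Coprimality using (Coprime; 1-coprimeTo)
open import Data.Rational using (ℚ; mkℚ)
import Data.Rational as ℚ
import Data.Rational.Properties as ℚₚ
import Data.Rational.Solver as ℚ-Solver
import Data.Rational.Unnormalised as ℚᵘ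
import Data.Rational.Unnormalised.Properties as ℚᵘₚ
open import Data.Integer.Tactic.RingSolver using (solve-∀)

D*X≤1+B*K⇒X≤K : ∀ {B D X K} → 2 ≤ D → B ≤ D → D ℕ.* X ≤ suc (B ℕ.* K) → X ≤ K
D*X≤1+B*K⇒X≤K {B} {D} {X} {K} 2≤D B≤D DX≤ = ℕₚ.≮⇒≥ λ K<X → ℕₚ.<-irrefl refl (begin-strict
    D ℕ.* suc K    ≤⟨ ℕₚ.*-monoʳ-≤ D K<X ⟩
    D ℕ.* X        ≤⟨ DX≤ ⟩
    suc (B ℕ.* K)  ≤⟨ s≤s (ℕₚ.*-monoˡ-≤ K B≤D) ⟩
    suc (D ℕ.* K)  <⟨ ℕₚ.+-monoˡ-< (D ℕ.* K) 2≤D ⟩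
    D ℕ.+ D ℕ.* K  ≡⟨ ℕₚ.*-suc D K ⟨
    D ℕ.* suc K    ∎)
  where open ℕₚ.≤-Reasoning

∣j∣≤∣i+j∣+∣i∣ : ∀ i j → ∣ j ∣ ≤ ∣ i + j ∣ ℕ.+ ∣ i ∣
∣j∣≤∣i+j∣+∣i∣ i j = subst (λ k → ∣ k ∣ ≤ ∣ i + j ∣ ℕ.+ ∣ i ∣) (cancel i j) (ℤₚ.∣i-j∣≤∣i∣+∣j∣ (i + j) i)
  where
  cancel : ∀ i j → i + j - i ≡ j
  cancel = solve-∀

∣i∣≤∣i-j∣+∣j∣ : ∀ i j → ∣ i ∣ ≤ ∣ i - j ∣ ℕ.+ ∣ j ∣
∣i∣≤∣i-j∣+∣j∣ i j = subst (λ k → ∣ k ∣ ≤ ∣ i - j ∣ ℕ.+ ∣ j ∣) (cancel i j) (ℤₚ.∣i+j∣≤∣i∣+∣j∣ (i - j) j)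
  where
  cancel : ∀ i j → i - j + j ≡ i
  cancel = solve-∀

∣v∣≤∣x*u+y*v∣ : ∀ {x y u v} → ∣ x ∣ < ∣ y ∣ → ∣ u ∣ ≤ ∣ v ∣ → ∣ v ∣ ≤ ∣ x * u + y * v ∣
∣v∣≤∣x*u+y*v∣ {x} {y} {u} {v} ∣x∣<∣y∣ ∣u∣≤∣v∣ =
  ℕₚ.+-cancelˡ-≤ (∣ x ∣ ℕ.* ∣ v ∣) _ _ (begin
    ∣ x ∣ ℕ.* ∣ v ∣ ℕ.+ ∣ v ∣              ≡⟨ ℕₚ.+-comm _ ∣ v ∣ ⟩
    suc ∣ x ∣ ℕ.* ∣ v ∣                    ≤⟨ ℕₚ.*-monoˡ-≤ ∣ v ∣ ∣x∣<∣y∣ ⟩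
    ∣ y ∣ ℕ.* ∣ v ∣                        ≡⟨ ℤₚ.∣i*j∣≡∣i∣*∣j∣ y v ⟨
    ∣ y * v ∣                              ≤⟨ ∣j∣≤∣i+j∣+∣i∣ (x * u) (y * v) ⟩
    ∣ x * u + y * v ∣ ℕ.+ ∣ x * u ∣        ≡⟨ cong (∣ x * u + y * v ∣ ℕ.+_) (ℤₚ.∣i*j∣≡∣i∣*∣j∣ x u) ⟩
    ∣ x * u + y * v ∣ ℕ.+ ∣ x ∣ ℕ.* ∣ u ∣  ≤⟨ ℕₚ.+-monoʳ-≤ _ (ℕₚ.*-monoʳ-≤ ∣ x ∣ ∣u∣≤∣v∣) ⟩
    ∣ x * u + y * v ∣ ℕ.+ ∣ x ∣ ℕ.* ∣ v ∣  ≡⟨ ℕₚ.+-comm (∣ x * u + y * v ∣) (∣ x ∣ ℕ.* ∣ v ∣) ⟩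
    ∣ x ∣ ℕ.* ∣ v ∣ ℕ.+ ∣ x * u + y * v ∣  ∎)
  where open ℕₚ.≤-Reasoning

∣i∣≡∣j∣⇒i≡j⊎i≡-j : ∀ i j → ∣ i ∣ ≡ ∣ j ∣ → i ≡ j ⊎ i ≡ - j
∣i∣≡∣j∣⇒i≡j⊎i≡-j (+ _)      (+ _)      refl = inj₁ refl
∣i∣≡∣j∣⇒i≡j⊎i≡-j (+ _)      -[1+ _ ]   refl = inj₂ refl
∣i∣≡∣j∣⇒i≡j⊎i≡-j -[1+ _ ]   (+ _)      refl = inj₂ refl
∣i∣≡∣j∣⇒i≡j⊎i≡-j -[1+ _ ]   -[1+ _ ]   refl = inj₁ refl

i*j≡+n⇒∣i+j∣≡∣i∣+∣j∣ : ∀ i j {n} → i * j ≡ + n → ∣ i + j ∣ ≡ ∣ i ∣ ℕ.+ ∣ j ∣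
i*j≡+n⇒∣i+j∣≡∣i∣+∣j∣ (+ m)           (+ n)             _ = refl
i*j≡+n⇒∣i+j∣≡∣i∣+∣j∣ (+ zero)        -[1+ n ]          _ = refl
i*j≡+n⇒∣i+j∣≡∣i∣+∣j∣ -[1+ m ]        (+ zero)          _ = cong suc (sym (ℕₚ.+-identityʳ m))
i*j≡+n⇒∣i+j∣≡∣i∣+∣j∣ -[1+ m ]        -[1+ n ]          _ = cong suc (sym (ℕₚ.+-suc m n))
i*j≡+n⇒∣i+j∣≡∣i∣+∣j∣ (+ suc m)       -[1+ n ]          ()
i*j≡+n⇒∣i+j∣≡∣i∣+∣j∣ -[1+ m ]        (+ suc n)         ()

i*i≡+∣i∣*∣i∣ : ∀ i → i * i ≡ + (∣ i ∣ ℕ.* ∣ i ∣)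
i*i≡+∣i∣*∣i∣ (+ n)    = sym (ℤₚ.pos-* n n)
i*i≡+∣i∣*∣i∣ -[1+ n ] = refl

∣i∣≤∣j∣⇒j*j-i*i≡+ : ∀ i j → ∣ i ∣ ≤ ∣ j ∣ → j * j - i * i ≡ + (∣ j ∣ ℕ.* ∣ j ∣ ℕ.∸ ∣ i ∣ ℕ.* ∣ i ∣)
∣i∣≤∣j∣⇒j*j-i*i≡+ i j ∣i∣≤∣j∣ = begin
  j * j - i * i                                      ≡⟨ cong₂ _-_ (i*i≡+∣i∣*∣i∣ j) (i*i≡+∣i∣*∣i∣ i) ⟩
  + (∣ j ∣ ℕ.* ∣ j ∣) - + (∣ i ∣ ℕ.* ∣ i ∣)           ≡⟨ ℤₚ.[+m]-[+n]≡m⊖n (∣ j ∣ ℕ.* ∣ j ∣) (∣ i ∣ ℕ.* ∣ i ∣) ⟩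
  ∣ j ∣ ℕ.* ∣ j ∣ ℤ.⊖ ∣ i ∣ ℕ.* ∣ i ∣                 ≡⟨ ℤₚ.⊖-≥ (ℕₚ.*-mono-≤ ∣i∣≤∣j∣ ∣i∣≤∣j∣) ⟩
  + (∣ j ∣ ℕ.* ∣ j ∣ ℕ.∸ ∣ i ∣ ℕ.* ∣ i ∣)             ∎
  where open ≡-Reasoning

∣x+y∣≡1⇒1+∣x∣≡∣y∣ : ∀ x y → ∣ x ∣ ≤ ∣ y ∣ → ∣ x + y ∣ ≡ 1 → suc ∣ x ∣ ≡ ∣ y ∣
∣x+y∣≡1⇒1+∣x∣≡∣y∣ x y ∣x∣≤∣y∣ ∣x+y∣≡1 = ℕₚ.≤-antisym (ℕₚ.≤∧≢⇒< ∣x∣≤∣y∣ ∣x∣≢∣y∣)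
  (subst (∣ y ∣ ≤_) (cong (ℕ._+ ∣ x ∣) ∣x+y∣≡1) (∣j∣≤∣i+j∣+∣i∣ x y))
  where
  ∣x∣≢∣y∣ : ∣ x ∣ ≢ ∣ y ∣
  ∣x∣≢∣y∣ ∣x∣≡∣y∣ with ∣i∣≡∣j∣⇒i≡j⊎i≡-j x y ∣x∣≡∣y∣
  ... | inj₁ refl with ℕₚ.m*n≡1⇒m≡1 2 ∣ x ∣ (trans (sym (ℤₚ.∣i*j∣≡∣i∣*∣j∣ (+ 2) x))
                                             (trans (cong ∣_∣ (sym (double x))) ∣x+y∣≡1))
    where
    double : ∀ x → x + x ≡ + 2 * x
    double = solve-∀
  ...   | ()
  ∣x∣≢∣y∣ _ | inj₂ refl with trans (sym (cong ∣_∣ (ℤₚ.+-inverseˡ y))) ∣x+y∣≡1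
  ...   | ()

∣ε*z∣≡∣ε∣⇒∣z∣≡1 : ∀ {ε z} → 1 ≤ ∣ ε ∣ → ∣ ε * z ∣ ≡ ∣ ε ∣ → ∣ z ∣ ≡ 1
∣ε*z∣≡∣ε∣⇒∣z∣≡1 {ε} {z} 1≤∣ε∣ ∣εz∣≡∣ε∣ = ℕₚ.*-cancelˡ-≡ (∣ z ∣) 1 (∣ ε ∣) {{ℕ.>-nonZero 1≤∣ε∣}}
  (trans (sym (ℤₚ.∣i*j∣≡∣i∣*∣j∣ ε z)) (trans ∣εz∣≡∣ε∣ (sym (ℕₚ.*-identityʳ ∣ ε ∣))))

∣εx+φy∣≡∣ε∣⇒1+∣x∣≡∣y∣ : ∀ ε φ x y → 1 ≤ ∣ ε ∣ → ∣ φ ∣ ≡ ∣ ε ∣ → ∣ x ∣ ≤ ∣ y ∣ →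
                        ∣ ε * x + φ * y ∣ ≡ ∣ ε ∣ → suc ∣ x ∣ ≡ ∣ y ∣
∣εx+φy∣≡∣ε∣⇒1+∣x∣≡∣y∣ ε φ x y 1≤∣ε∣ ∣φ∣≡∣ε∣ ∣x∣≤∣y∣ ∣εx+φy∣≡∣ε∣ with ∣i∣≡∣j∣⇒i≡j⊎i≡-j φ ε ∣φ∣≡∣ε∣
... | inj₁ refl = ∣x+y∣≡1⇒1+∣x∣≡∣y∣ x y ∣x∣≤∣y∣
  (∣ε*z∣≡∣ε∣⇒∣z∣≡1 {ε} {x + y} 1≤∣ε∣ (trans (cong ∣_∣ (ℤₚ.*-distribˡ-+ ε x y)) ∣εx+φy∣≡∣ε∣))
... | inj₂ refl = subst (suc ∣ x ∣ ≡_) (ℤₚ.∣-i∣≡∣i∣ y)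
  (∣x+y∣≡1⇒1+∣x∣≡∣y∣ x (- y) (subst (∣ x ∣ ≤_) (sym (ℤₚ.∣-i∣≡∣i∣ y)) ∣x∣≤∣y∣)
    (∣ε*z∣≡∣ε∣⇒∣z∣≡1 {ε} {x - y} 1≤∣ε∣ (trans (cong ∣_∣ (sym (factor-out ε x y))) ∣εx+φy∣≡∣ε∣)))
  where
  factor-out : ∀ ε x y → ε * x + - ε * y ≡ ε * (x - y)
  factor-out = solve-∀

∣i∣≤n⇒-n≤i≤n : ∀ i {n} → ∣ i ∣ ≤ n → - + n ℤ.≤ i × i ℤ.≤ + n
∣i∣≤n⇒-n≤i≤n (+ m)    m≤n             = ℤₚ.neg-≤-pos , ℤ.+≤+ m≤n
∣i∣≤n⇒-n≤i≤n -[1+ m ] (s≤s m≤n)       = ℤ.-≤- m≤n , ℤ.-≤+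

-- Constructively the stable index cannot be found, but its nonexistence is refutable:
-- every strict drop lowers a bound on E.
antitone⇒¬¬stable : (E : ℕ → ℕ) → (∀ {i k} → i ≤ k → E k ≤ E i) →
                    ¬ ¬ (Σ ℕ λ i → ∀ k → i ≤ k → E k ≡ E i)
antitone⇒¬¬stable E antitone unstable = bounded (suc (E 0)) 0 (ℕₚ.n<1+n (E 0))
  where
  bounded : ∀ B i → E i < B → ⊥
  bounded zero    i ()
  bounded (suc B) i (s≤s Ei≤B) = unstable (i , stable)
    where
    stable : ∀ k → i ≤ k → E k ≡ E i
    stable k i≤k with E k ℕ.≟ E i
    ... | yes Ek≡Ei = Ek≡Ei
    ... | no  Ek≢Ei = ⊥-elim (bounded B k (ℕₚ.<-≤-trans (ℕₚ.≤∧≢⇒< (antitone i≤k) Ek≢Ei) Ei≤B))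

-- 2 × 2 integer matrices

mat-cong : ∀ {a₁ b₁ c₁ d₁ a₂ b₂ c₂ d₂} →
  a₁ ≡ a₂ → b₁ ≡ b₂ → c₁ ≡ c₂ → d₁ ≡ d₂ → mat a₁ b₁ c₁ d₁ ≡ mat a₂ b₂ c₂ d₂
mat-cong refl refl refl refl = refl

⊗-assoc : ∀ X Y Z → (X ⊗ Y) ⊗ Z ≡ X ⊗ (Y ⊗ Z)
⊗-assoc X Y Z = mat-cong (entry (a X) (b X) (a Z) (c Z)) (entry (a X) (b X) (b Z) (d Z))
                         (entry (c X) (d X) (a Z) (c Z)) (entry (c X) (d X) (b Z) (d Z))
  where
  entry : ∀ x y u v → (x * a Y + y * c Y) * u + (x * b Y + y * d Y) * v
                    ≡ x * (a Y * u + b Y * v) + y * (c Y * u + d Y * v)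
  entry x y u v = lemma x y u v (a Y) (b Y) (c Y) (d Y)
    where
    lemma : ∀ x y u v p q r s → (x * p + y * r) * u + (x * q + y * s) * v
                              ≡ x * (p * u + q * v) + y * (r * u + s * v)
    lemma = solve-∀

⊗-identityˡ : ∀ X → I₂ ⊗ X ≡ X
⊗-identityˡ X = mat-cong (entry (a X) (c X)) (entry (b X) (d X)) (entry′ (a X) (c X)) (entry′ (b X) (d X))
  where
  entry : ∀ u v → + 1 * u + + 0 * v ≡ u
  entry = solve-∀
  entry′ : ∀ u v → + 0 * u + + 1 * v ≡ v
  entry′ = solve-∀

⊗-identityʳ : ∀ X → X ⊗ I₂ ≡ X
⊗-identityʳ X = mat-cong (entry (a X) (b X)) (entry′ (a X) (b X)) (entry (c X) (d X)) (entry′ (c X) (d X))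
  where
  entry : ∀ x y → x * + 1 + y * + 0 ≡ x
  entry = solve-∀
  entry′ : ∀ x y → x * + 0 + y * + 1 ≡ y
  entry′ = solve-∀

det : Mat → ℤ
det M = a M * d M - b M * c M

transpose : Mat → Mat
transpose M = mat (a M) (c M) (b M) (d M)

det-transpose : ∀ M → det (transpose M) ≡ det M
det-transpose M = cong (λ z → a M * d M - z) (ℤₚ.*-comm (c M) (b M))

det-⊗ : ∀ X Y → det (X ⊗ Y) ≡ det X * det Y
det-⊗ X Y = lemma (a X) (b X) (c X) (d X) (a Y) (b Y) (c Y) (d Y)
  where
  lemma : ∀ a b c d a′ b′ c′ d′ →
    (a * a′ + b * c′) * (c * b′ + d * d′) - (a * b′ + b * d′) * (c * a′ + d * c′)
    ≡ (a * d - b * c) * (a′ * d′ - b′ * c′)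
  lemma = solve-∀

∣det∣-⊗ : ∀ X Y → ∣ det X ∣ ≡ 1 → ∣ det Y ∣ ≡ 1 → ∣ det (X ⊗ Y) ∣ ≡ 1
∣det∣-⊗ X Y ∣detX∣≡1 ∣detY∣≡1 = begin
  ∣ det (X ⊗ Y) ∣             ≡⟨ cong ∣_∣ (det-⊗ X Y) ⟩
  ∣ det X * det Y ∣           ≡⟨ ℤₚ.∣i*j∣≡∣i∣*∣j∣ (det X) (det Y) ⟩
  ∣ det X ∣ ℕ.* ∣ det Y ∣     ≡⟨ cong₂ ℕ._*_ ∣detX∣≡1 ∣detY∣≡1 ⟩
  1                           ∎
  where open ≡-Reasoning

det≢0 : ∀ {M} → ∣ det M ∣ ≡ 1 → det M ≢ + 0
det≢0 ∣det∣≡1 det≡0 with trans (sym (cong ∣_∣ det≡0)) ∣det∣≡1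
... | ()

b≢0 : ∀ {M} → ∣ det M ∣ ≡ 1 → ∣ a M ∣ ≤ ∣ b M ∣ → b M ≢ + 0
b≢0 {mat a b c d} ∣det∣≡1 ∣a∣≤0 refl with ℤₚ.∣i∣≡0⇒i≡0 {a} (ℕₚ.n≤0⇒n≡0 ∣a∣≤0)
... | refl = det≢0 {mat (+ 0) (+ 0) c d} ∣det∣≡1 refl

∣det∣-evalWord : ∀ {v} (ε α : Fin v → ℤ) → (∀ i → IsSign (ε i)) → ∀ w → ∣ det (evalWord ε α w) ∣ ≡ 1
∣det∣-evalWord ε α sign []      = refl
∣det∣-evalWord ε α sign (i ∷ w) =
  ∣det∣-⊗ (Agen (ε i) (α i)) (evalWord ε α w) (∣det∣-Agen (sign i)) (∣det∣-evalWord ε α sign w)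
  where
  ∣det∣-Agen : ∀ {e} → IsSign e → ∣ det (Agen e (α i)) ∣ ≡ 1
  ∣det∣-Agen (inj₁ refl) = refl
  ∣det∣-Agen (inj₂ refl) = refl

-- Admissible matrices

record Admissible (M : Mat) : Set where
  field
    2≤∣d∣   : 2 ≤ ∣ d M ∣
    ∣a∣≤∣b∣ : ∣ a M ∣ ≤ ∣ b M ∣
    ∣c∣≤∣d∣ : ∣ c M ∣ ≤ ∣ d M ∣
    ∣a∣≤∣c∣ : ∣ a M ∣ ≤ ∣ c M ∣
    ∣b∣≤∣d∣ : ∣ b M ∣ ≤ ∣ d M ∣
    ∣det∣≡1 : ∣ det M ∣ ≡ 1

-- The conditions b ≢ 0 and c ≢ 0 of Cond are dropped: they follow from the others (b≢0).
fromCond : ∀ {M} → Cond M → ∣ det M ∣ ≡ 1 → Admissible M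
fromCond (2≤∣d∣ , _ , _ , ∣a∣≤∣b∣ , ∣c∣≤∣d∣ , ∣a∣≤∣c∣ , ∣b∣≤∣d∣) ∣det∣≡1 = record
  { 2≤∣d∣ = 2≤∣d∣ ; ∣a∣≤∣b∣ = ∣a∣≤∣b∣ ; ∣c∣≤∣d∣ = ∣c∣≤∣d∣
  ; ∣a∣≤∣c∣ = ∣a∣≤∣c∣ ; ∣b∣≤∣d∣ = ∣b∣≤∣d∣ ; ∣det∣≡1 = ∣det∣≡1 }

admissible-transpose : ∀ {M} → Admissible M → Admissible (transpose M)
admissible-transpose {M} adm = record
  { 2≤∣d∣ = 2≤∣d∣ ; ∣a∣≤∣b∣ = ∣a∣≤∣c∣ ; ∣c∣≤∣d∣ = ∣b∣≤∣d∣
  ; ∣a∣≤∣c∣ = ∣a∣≤∣b∣ ; ∣b∣≤∣d∣ = ∣c∣≤∣d∣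
  ; ∣det∣≡1 = trans (cong ∣_∣ (det-transpose M)) ∣det∣≡1 }
  where open Admissible adm

-- Were c = ± d, then d would divide det = ± 1.
∣c∣<∣d∣ : ∀ {M} → Admissible M → ∣ c M ∣ < ∣ d M ∣
∣c∣<∣d∣ {M} adm = ℕₚ.≤∧≢⇒< ∣c∣≤∣d∣ ∣c∣≢∣d∣
  where
  open Admissible adm
  d∤det : ∀ x → det M ≡ d M * x → ⊥
  d∤det x det≡dx = ℕₚ.<-irrefl refl (ℕₚ.≤-trans 2≤∣d∣ (ℕₚ.≤-reflexive ∣d∣≡1))
    where
    ∣d∣≡1 : ∣ d M ∣ ≡ 1
    ∣d∣≡1 = ℕₚ.m*n≡1⇒m≡1 ∣ d M ∣ ∣ x ∣
              (trans (sym (ℤₚ.∣i*j∣≡∣i∣*∣j∣ (d M) x)) (trans (cong ∣_∣ (sym det≡dx)) ∣det∣≡1))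
  ∣c∣≢∣d∣ : ∣ c M ∣ ≢ ∣ d M ∣
  ∣c∣≢∣d∣ ∣c∣≡∣d∣ with ∣i∣≡∣j∣⇒i≡j⊎i≡-j (c M) (d M) ∣c∣≡∣d∣
  ... | inj₁ c≡d  = d∤det (a M - b M) (trans (cong (λ z → a M * d M - b M * z) c≡d) (factor₁ (a M) (b M) (d M)))
    where
    factor₁ : ∀ a b d → a * d - b * d ≡ d * (a - b)
    factor₁ = solve-∀
  ... | inj₂ c≡-d = d∤det (a M + b M) (trans (cong (λ z → a M * d M - b M * z) c≡-d) (factor₂ (a M) (b M) (d M)))
    where
    factor₂ : ∀ a b d → a * d - b * - d ≡ d * (a + b)
    factor₂ = solve-∀

∣b∣<∣d∣ : ∀ {M} → Admissible M → ∣ b M ∣ < ∣ d M ∣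
∣b∣<∣d∣ adm = ∣c∣<∣d∣ (admissible-transpose adm)

c≢0 : ∀ {M} → Admissible M → c M ≢ + 0
c≢0 {M} adm = b≢0 {transpose M} (Admissible.∣det∣≡1 (admissible-transpose adm)) (Admissible.∣a∣≤∣c∣ adm)

d≢0 : ∀ {M} → Admissible M → d M ≢ + 0
d≢0 adm d≡0 with subst (λ z → 2 ≤ ∣ z ∣) d≡0 (Admissible.2≤∣d∣ adm)
... | ()

1≤∣c∣ : ∀ {M} → Admissible M → 1 ≤ ∣ c M ∣
1≤∣c∣ {M} adm = ℕₚ.n≢0⇒n>0 (c≢0 adm ∘ ℤₚ.∣i∣≡0⇒i≡0 {c M})

∣a*σ+b∣≤∣c*σ+d∣ : ∀ {M} → Admissible M → ∀ {σ} → ∣ σ ∣ ≡ 1 →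
                  ∣ a M * σ + b M ∣ ≤ ∣ c M * σ + d M ∣
∣a*σ+b∣≤∣c*σ+d∣ {M} adm {σ} ∣σ∣≡1 = D*X≤1+B*K⇒X≤K 2≤∣d∣ ∣b∣≤∣d∣ (begin
  ∣ d M ∣ ℕ.* ∣ x ∣               ≡⟨ ℤₚ.∣i*j∣≡∣i∣*∣j∣ (d M) x ⟨
  ∣ d M * x ∣                     ≡⟨ cong ∣_∣ (inverse (a M) (b M) (c M) (d M) σ) ⟩
  ∣ σ * det M + b M * y ∣         ≤⟨ ℤₚ.∣i+j∣≤∣i∣+∣j∣ (σ * det M) (b M * y) ⟩
  ∣ σ * det M ∣ ℕ.+ ∣ b M * y ∣   ≡⟨ cong₂ ℕ._+_ ∣σ*det∣≡1 (ℤₚ.∣i*j∣≡∣i∣*∣j∣ (b M) y) ⟩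
  suc (∣ b M ∣ ℕ.* ∣ y ∣)         ∎)
  where
  open Admissible adm
  open ℕₚ.≤-Reasoning
  x = a M * σ + b M
  y = c M * σ + d M
  inverse : ∀ a b c d σ → d * (a * σ + b) ≡ σ * (a * d - b * c) + b * (c * σ + d)
  inverse = solve-∀
  ∣σ*det∣≡1 : ∣ σ * det M ∣ ≡ 1
  ∣σ*det∣≡1 = trans (ℤₚ.∣i*j∣≡∣i∣*∣j∣ σ (det M)) (cong₂ ℕ._*_ ∣σ∣≡1 ∣det∣≡1)

-- Write 2 (u , v) = (v + u) (1 , 1) + (v - u) (-1 , 1); the two coefficients have the same
-- sign, and so do the two summands of the second row, so the triangle inequality for the
-- first row is matched by an equality for the second.
∣a*u+b*v∣≤∣c*u+d*v∣ : ∀ {M} → Admissible M → ∀ u v → ∣ u ∣ ≤ ∣ v ∣ →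
                      ∣ a M * u + b M * v ∣ ≤ ∣ c M * u + d M * v ∣
∣a*u+b*v∣≤∣c*u+d*v∣ {M} adm u v ∣u∣≤∣v∣ = ℕₚ.*-cancelˡ-≤ 2 (begin
  2 ℕ.* ∣ a M * u + b M * v ∣              ≡⟨ ∣2*∣ (a M) (b M) ⟩
  ∣ λ₊ * p₊ + λ₋ * p₋ ∣                    ≤⟨ ℤₚ.∣i+j∣≤∣i∣+∣j∣ (λ₊ * p₊) (λ₋ * p₋) ⟩
  ∣ λ₊ * p₊ ∣ ℕ.+ ∣ λ₋ * p₋ ∣              ≡⟨ cong₂ ℕ._+_ (∣*∣ λ₊ p₊) (∣*∣ λ₋ p₋) ⟩
  ∣ λ₊ ∣ ℕ.* ∣ p₊ ∣ ℕ.+ ∣ λ₋ ∣ ℕ.* ∣ p₋ ∣  ≤⟨ ℕₚ.+-mono-≤ (ℕₚ.*-monoʳ-≤ ∣ λ₊ ∣ (∣a*σ+b∣≤∣c*σ+d∣ adm refl))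
                                                          (ℕₚ.*-monoʳ-≤ ∣ λ₋ ∣ (∣a*σ+b∣≤∣c*σ+d∣ adm refl)) ⟩
  ∣ λ₊ ∣ ℕ.* ∣ q₊ ∣ ℕ.+ ∣ λ₋ ∣ ℕ.* ∣ q₋ ∣  ≡⟨ cong₂ ℕ._+_ (∣*∣ λ₊ q₊) (∣*∣ λ₋ q₋) ⟨
  ∣ λ₊ * q₊ ∣ ℕ.+ ∣ λ₋ * q₋ ∣              ≡⟨ i*j≡+n⇒∣i+j∣≡∣i∣+∣j∣ (λ₊ * q₊) (λ₋ * q₋) same-sign ⟨
  ∣ λ₊ * q₊ + λ₋ * q₋ ∣                    ≡⟨ ∣2*∣ (c M) (d M) ⟨
  2 ℕ.* ∣ c M * u + d M * v ∣              ∎)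
  where
  open Admissible adm
  open ℕₚ.≤-Reasoning
  ∣*∣ : ∀ i j → ∣ i * j ∣ ≡ ∣ i ∣ ℕ.* ∣ j ∣
  ∣*∣ = ℤₚ.∣i*j∣≡∣i∣*∣j∣
  λ₊ = v + u
  λ₋ = v - u
  p₊ = a M * + 1 + b M
  p₋ = a M * - + 1 + b M
  q₊ = c M * + 1 + d M
  q₋ = c M * - + 1 + d M
  ∣2*∣ : ∀ x y → 2 ℕ.* ∣ x * u + y * v ∣ ≡ ∣ λ₊ * (x * + 1 + y) + λ₋ * (x * - + 1 + y) ∣
  ∣2*∣ x y = trans (sym (∣*∣ (+ 2) (x * u + y * v))) (cong ∣_∣ (split x y u v))
    where
    split : ∀ x y u v → + 2 * (x * u + y * v) ≡ (v + u) * (x * + 1 + y) + (v - u) * (x * - + 1 + y)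
    split = solve-∀
  regroup : ∀ x y z w → (x * y) * (z * w) ≡ (x * z) * (y * w)
  regroup = solve-∀
  difference-of-squares : ∀ x y → (x + y) * (x - y) ≡ x * x - y * y
  difference-of-squares = solve-∀
  q₊*q₋ : ∀ c d → (c * + 1 + d) * (c * - + 1 + d) ≡ d * d - c * c
  q₊*q₋ = solve-∀
  v²-u² = ∣ v ∣ ℕ.* ∣ v ∣ ℕ.∸ ∣ u ∣ ℕ.* ∣ u ∣
  d²-c² = ∣ d M ∣ ℕ.* ∣ d M ∣ ℕ.∸ ∣ c M ∣ ℕ.* ∣ c M ∣
  same-sign : λ₊ * q₊ * (λ₋ * q₋) ≡ + (v²-u² ℕ.* d²-c²)
  same-sign = trans (regroup λ₊ q₊ λ₋ q₋) (trans
    (cong₂ _*_ (trans (difference-of-squares v u) (∣i∣≤∣j∣⇒j*j-i*i≡+ u v ∣u∣≤∣v∣))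
               (trans (q₊*q₋ (c M) (d M)) (∣i∣≤∣j∣⇒j*j-i*i≡+ (c M) (d M) ∣c∣≤∣d∣)))
    (sym (ℤₚ.pos-* v²-u² d²-c²)))

∣x*a+y*c∣≤∣x*b+y*d∣ : ∀ {M} → Admissible M → ∀ x y → ∣ x ∣ ≤ ∣ y ∣ →
                      ∣ x * a M + y * c M ∣ ≤ ∣ x * b M + y * d M ∣
∣x*a+y*c∣≤∣x*b+y*d∣ {M} adm x y ∣x∣≤∣y∣ =
  subst₂ _≤_ (cong ∣_∣ (commute (a M) (c M))) (cong ∣_∣ (commute (b M) (d M)))
         (∣a*u+b*v∣≤∣c*u+d*v∣ (admissible-transpose adm) x y ∣x∣≤∣y∣)
  where
  commute : ∀ p q → p * x + q * y ≡ x * p + y * q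
  commute p q = cong₂ _+_ (ℤₚ.*-comm p x) (ℤₚ.*-comm q y)

∣d∣<∣d[X⊗Y]∣ : ∀ {X Y} → Admissible X → Admissible Y → ∣ d X ∣ < ∣ d (X ⊗ Y) ∣
∣d∣<∣d[X⊗Y]∣ {X} {Y} admX admY =
  growth (∣c∣<∣d∣ admX) (∣b∣<∣d∣ admY) (Admissible.2≤∣d∣ admY) (begin
    ∣ d X ∣ ℕ.* ∣ d Y ∣                        ≡⟨ ℤₚ.∣i*j∣≡∣i∣*∣j∣ (d X) (d Y) ⟨
    ∣ d X * d Y ∣                              ≤⟨ ∣j∣≤∣i+j∣+∣i∣ (c X * b Y) (d X * d Y) ⟩
    ∣ d (X ⊗ Y) ∣ ℕ.+ ∣ c X * b Y ∣            ≡⟨ cong (∣ d (X ⊗ Y) ∣ ℕ.+_) (ℤₚ.∣i*j∣≡∣i∣*∣j∣ (c X) (b Y)) ⟩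
    ∣ d (X ⊗ Y) ∣ ℕ.+ ∣ c X ∣ ℕ.* ∣ b Y ∣      ∎)
  where
  open ℕₚ.≤-Reasoning
  growth : ∀ {C D B D′ Z} → C < D → B < D′ → 1 < D′ → D ℕ.* D′ ≤ Z ℕ.+ C ℕ.* B → D < Z
  growth {C} {suc p} {B} {suc q} {Z} (s≤s C≤p) (s≤s B≤q) (s≤s 1≤q) DD′≤ =
    ℕₚ.≤-trans (s≤s (ℕₚ.m<m+n p 1≤q)) (ℕₚ.+-cancelˡ-≤ (p ℕ.* q) _ _ (begin
      p ℕ.* q ℕ.+ suc (p ℕ.+ q)    ≡⟨ expand p q ⟨
      suc p ℕ.* suc q              ≤⟨ DD′≤ ⟩
      Z ℕ.+ C ℕ.* B                ≤⟨ ℕₚ.+-monoʳ-≤ Z (ℕₚ.*-mono-≤ C≤p B≤q) ⟩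
      Z ℕ.+ p ℕ.* q                ≡⟨ ℕₚ.+-comm Z (p ℕ.* q) ⟩
      p ℕ.* q ℕ.+ Z                ∎))
    where
    expand : ∀ p q → suc p ℕ.* suc q ≡ p ℕ.* q ℕ.+ suc (p ℕ.+ q)
    expand = ℕ-Solver.solve-∀

admissible-⊗ : ∀ {X Y} → Admissible X → Admissible Y → Admissible (X ⊗ Y)
admissible-⊗ {X} {Y} admX admY = record
  { 2≤∣d∣   = ℕₚ.≤-trans (X.2≤∣d∣) (ℕₚ.<⇒≤ (∣d∣<∣d[X⊗Y]∣ admX admY))
  ; ∣a∣≤∣b∣ = ∣x*a+y*c∣≤∣x*b+y*d∣ admY (a X) (b X) X.∣a∣≤∣b∣
  ; ∣c∣≤∣d∣ = ∣x*a+y*c∣≤∣x*b+y*d∣ admY (c X) (d X) X.∣c∣≤∣d∣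
  ; ∣a∣≤∣c∣ = ∣a*u+b*v∣≤∣c*u+d*v∣ admX (a Y) (c Y) Y.∣a∣≤∣c∣
  ; ∣b∣≤∣d∣ = ∣a*u+b*v∣≤∣c*u+d*v∣ admX (b Y) (d Y) Y.∣b∣≤∣d∣
  ; ∣det∣≡1 = ∣det∣-⊗ X Y X.∣det∣≡1 Y.∣det∣≡1
  }
  where
  module X = Admissible admX
  module Y = Admissible admY

admissible-^ : ∀ {M} → Admissible M → ∀ k → Admissible (M ^ᴹ suc k)
admissible-^ {M} adm zero    = subst Admissible (sym (⊗-identityʳ M)) adm
admissible-^     adm (suc k) = admissible-⊗ adm (admissible-^ adm k)

admissible-^⊗ : ∀ {M W} → Admissible M → Admissible W → ∀ k → Admissible (M ^ᴹ k ⊗ W)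
admissible-^⊗ {W = W} admM admW zero    = subst Admissible (sym (⊗-identityˡ W)) admW
admissible-^⊗         admM admW (suc k) = admissible-⊗ (admissible-^ admM k) admW

∣c[W⊗V]∣≤ : ∀ W {V} → Admissible V → ∣ c (W ⊗ V) ∣ ≤ (∣ c W ∣ ℕ.+ ∣ d W ∣) ℕ.* ∣ c V ∣
∣c[W⊗V]∣≤ W {V} admV = begin
  ∣ c W * a V + d W * c V ∣                    ≤⟨ ℤₚ.∣i+j∣≤∣i∣+∣j∣ (c W * a V) (d W * c V) ⟩
  ∣ c W * a V ∣ ℕ.+ ∣ d W * c V ∣              ≡⟨ cong₂ ℕ._+_ (ℤₚ.∣i*j∣≡∣i∣*∣j∣ (c W) (a V)) (ℤₚ.∣i*j∣≡∣i∣*∣j∣ (d W) (c V)) ⟩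
  ∣ c W ∣ ℕ.* ∣ a V ∣ ℕ.+ ∣ d W ∣ ℕ.* ∣ c V ∣  ≤⟨ ℕₚ.+-monoˡ-≤ _ (ℕₚ.*-monoʳ-≤ ∣ c W ∣ (Admissible.∣a∣≤∣c∣ admV)) ⟩
  ∣ c W ∣ ℕ.* ∣ c V ∣ ℕ.+ ∣ d W ∣ ℕ.* ∣ c V ∣  ≡⟨ ℕₚ.*-distribʳ-+ (∣ c V ∣) (∣ c W ∣) (∣ d W ∣) ⟨
  (∣ c W ∣ ℕ.+ ∣ d W ∣) ℕ.* ∣ c V ∣            ∎
  where open ℕₚ.≤-Reasoning

exceptional : ∀ {M} → suc ∣ a M ∣ ≡ ∣ c M ∣ → suc ∣ b M ∣ ≡ ∣ d M ∣ → ∣ d M ∣ ≡ suc ∣ c M ∣ → Exceptional M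
exceptional {M} 1+∣a∣≡∣c∣ 1+∣b∣≡∣d∣ ∣d∣≡1+∣c∣ =
  ℕₚ.suc-injective (trans 1+∣b∣≡∣d∣ ∣d∣≡1+∣c∣) ,
  sym ∣d∣∸1≡∣c∣ ,
  trans ∣d∣∸1≡∣c∣ (trans (sym 1+∣a∣≡∣c∣) (ℕₚ.+-comm 1 ∣ a M ∣))
  where
  ∣d∣∸1≡∣c∣ : ∣ d M ∣ ℕ.∸ 1 ≡ ∣ c M ∣
  ∣d∣∸1≡∣c∣ = cong (ℕ._∸ 1) ∣d∣≡1+∣c∣

infix 4 _∣ˡ_

record _∣ˡ_ (W M : Mat) : Set where
  constructor factor
  field
    cofactor            : Mat
    admissible-cofactor : Admissible cofactor
    factorisation       : M ≡ W ⊗ cofactor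

∣ˡ-trans : ∀ {W M N} → W ∣ˡ M → M ∣ˡ N → W ∣ˡ N
∣ˡ-trans {W} (factor V admV M≡WV) (factor U admU N≡MU) =
  factor (V ⊗ U) (admissible-⊗ admV admU) (trans N≡MU (trans (cong (_⊗ U) M≡WV) (⊗-assoc W V U)))

∣ˡ⇒∣d∣< : ∀ {W M} → Admissible W → W ∣ˡ M → ∣ d W ∣ < ∣ d M ∣
∣ˡ⇒∣d∣< admW (factor V admV refl) = ∣d∣<∣d[X⊗Y]∣ admW admV

^ᴹ-cases : ∀ {Y} → Admissible Y → ∀ {n} → 1 ≤ n → Y ^ᴹ n ≡ Y ⊎ Y ∣ˡ Y ^ᴹ n
^ᴹ-cases {Y} adm {suc zero}    _ = inj₁ (⊗-identityʳ Y)
^ᴹ-cases {Y} adm {suc (suc n)} _ = inj₂ (factor (Y ^ᴹ suc n) (admissible-^ adm n) refl)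

-- Rational approximations

1/[1+_] : ℕ → ℚ
1/[1+ n ] = mkℚ (+ 1) n (1-coprimeTo (suc n))

1/[1+_]>0 : ∀ n → 1/[1+ n ] ℚ.> ℚ.0ℚ
1/[1+_]>0 n = ℚ.*<* (ℤ.+<+ (s≤s z≤n))

ratioᵘ : ℤ → ℤ → ℚᵘ.ℚᵘ
ratioᵘ x (+ zero)  = ℚᵘ.0ℚᵘ
ratioᵘ x (+ suc n) = ℚᵘ.mkℚᵘ x n
ratioᵘ x -[1+ n ]  = ℚᵘ.mkℚᵘ (- x) n

toℚᵘ-ratio : ∀ x y → ℚ.toℚᵘ (ratio x y) ℚᵘ.≃ ratioᵘ x y
toℚᵘ-ratio x (+ zero)  = ℚᵘₚ.≃-refl
toℚᵘ-ratio x (+ suc n) = ℚₚ.toℚᵘ-fromℚᵘ (ℚᵘ.mkℚᵘ x n)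
toℚᵘ-ratio x -[1+ n ]  = ℚₚ.toℚᵘ-fromℚᵘ (ℚᵘ.mkℚᵘ (- x) n)

∣ratioᵘ-ratioᵘ∣ : ∀ x y x′ y′ → y ≢ + 0 → y′ ≢ + 0 →
  Σ ℕ λ k → suc k ≡ ∣ y ∣ ℕ.* ∣ y′ ∣
          × ℚᵘ.∣ ratioᵘ x y ℚᵘ.- ratioᵘ x′ y′ ∣ ≡ ℚᵘ.mkℚᵘ (+ ∣ x * y′ - x′ * y ∣) k
∣ratioᵘ-ratioᵘ∣ x (+ zero)  x′ y′        y≢0 _  = ⊥-elim (y≢0 refl)
∣ratioᵘ-ratioᵘ∣ x y         x′ (+ zero)  _ y′≢0 = ⊥-elim (y′≢0 refl)
∣ratioᵘ-ratioᵘ∣ x (+ suc m) x′ (+ suc n) _ _ =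
  _ , refl , cong (λ z → ℚᵘ.mkℚᵘ (+ ∣ z ∣) _) (identity x x′ (+ suc m) (+ suc n))
  where
  identity : ∀ x x′ y y′ → x * y′ + - x′ * y ≡ x * y′ - x′ * y
  identity = solve-∀
∣ratioᵘ-ratioᵘ∣ x -[1+ m ]  x′ (+ suc n) _ _ =
  _ , refl , cong (λ z → ℚᵘ.mkℚᵘ (+ z) _)
                  (trans (cong ∣_∣ (identity x x′ (+ suc m) (+ suc n))) (ℤₚ.∣-i∣≡∣i∣ (x * + suc n - x′ * -[1+ m ])))
  where
  identity : ∀ x x′ y y′ → - x * y′ + - x′ * y ≡ - (x * y′ - x′ * - y)
  identity = solve-∀
∣ratioᵘ-ratioᵘ∣ x (+ suc m) x′ -[1+ n ]  _ _ =
  _ , refl , cong (λ z → ℚᵘ.mkℚᵘ (+ z) _)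
                  (trans (cong ∣_∣ (identity x x′ (+ suc m) (+ suc n))) (ℤₚ.∣-i∣≡∣i∣ (x * -[1+ n ] - x′ * + suc m)))
  where
  identity : ∀ x x′ y y′ → x * y′ + - - x′ * y ≡ - (x * - y′ - x′ * y)
  identity = solve-∀
∣ratioᵘ-ratioᵘ∣ x -[1+ m ]  x′ -[1+ n ]  _ _ =
  _ , refl , cong (λ z → ℚᵘ.mkℚᵘ (+ ∣ z ∣) _) (identity x x′ (+ suc m) (+ suc n))
  where
  identity : ∀ x x′ y y′ → - x * y′ + - - x′ * y ≡ x * - y′ - x′ * - y
  identity = solve-∀

module _ {x y x′ y′ : ℤ} (y≢0 : y ≢ + 0) (y′≢0 : y′ ≢ + 0) where
  private
    k : ℕ
    k = proj₁ (∣ratioᵘ-ratioᵘ∣ x y x′ y′ y≢0 y′≢0)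
    1+k≡∣y∣*∣y′∣ : suc k ≡ ∣ y ∣ ℕ.* ∣ y′ ∣
    1+k≡∣y∣*∣y′∣ = proj₁ (proj₂ (∣ratioᵘ-ratioᵘ∣ x y x′ y′ y≢0 y′≢0))
    cross : ℕ
    cross = ∣ x * y′ - x′ * y ∣

    toℚᵘ-∣ratio-ratio∣ : ℚ.toℚᵘ ℚ.∣ ratio x y ℚ.- ratio x′ y′ ∣ ℚᵘ.≃ ℚᵘ.mkℚᵘ (+ cross) k
    toℚᵘ-∣ratio-ratio∣ = ℚᵘₚ.≃-trans (ℚₚ.toℚᵘ-homo-∣-∣ (ratio x y ℚ.- ratio x′ y′))
      (ℚᵘₚ.≃-trans (ℚᵘₚ.∣-∣-cong (ℚᵘₚ.≃-trans (ℚₚ.toℚᵘ-homo-+ (ratio x y) (ℚ.- ratio x′ y′))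
                                   (ℚᵘₚ.+-cong (toℚᵘ-ratio x y)
                                     (ℚᵘₚ.≃-trans (ℚₚ.toℚᵘ-homo‿- (ratio x′ y′)) (ℚᵘₚ.-‿cong (toℚᵘ-ratio x′ y′))))))
                   (ℚᵘₚ.≃-reflexive (proj₂ (proj₂ (∣ratioᵘ-ratioᵘ∣ x y x′ y′ y≢0 y′≢0)))))

  ∣ratio-ratio∣≤1/[1+_] : ∀ L → cross ℕ.* suc L ≤ ∣ y ∣ ℕ.* ∣ y′ ∣ →
                          ℚ.∣ ratio x y ℚ.- ratio x′ y′ ∣ ℚ.≤ 1/[1+ L ]
  ∣ratio-ratio∣≤1/[1+_] L cross≤ = ℚₚ.toℚᵘ-cancel-≤ (ℚᵘₚ.≤-respˡ-≃ (ℚᵘₚ.≃-sym toℚᵘ-∣ratio-ratio∣)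
    (ℚᵘ.*≤* (subst₂ ℤ._≤_ (ℤₚ.pos-* cross (suc L)) (sym (ℤₚ.*-identityˡ (+ suc k)))
                          (ℤ.+≤+ (subst (cross ℕ.* suc L ≤_) (sym 1+k≡∣y∣*∣y′∣) cross≤)))))

  ∣ratio-ratio∣<1/[1+_]⇒ : ∀ L → ℚ.∣ ratio x y ℚ.- ratio x′ y′ ∣ ℚ.< 1/[1+ L ] →
                           cross ℕ.* suc L < ∣ y ∣ ℕ.* ∣ y′ ∣
  ∣ratio-ratio∣<1/[1+_]⇒ L lt with ℚᵘₚ.<-respˡ-≃ toℚᵘ-∣ratio-ratio∣ (ℚₚ.toℚᵘ-mono-< lt)
  ... | ℚᵘ.*<* lt′ with subst₂ ℤ._<_ (sym (ℤₚ.pos-* cross (suc L))) (ℤₚ.*-identityˡ (+ suc k)) lt′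
  ...   | ℤ.+<+ cross<1+k = subst (cross ℕ.* suc L <_) 1+k≡∣y∣*∣y′∣ cross<1+k

-1≤ratio≤1 : ∀ {x y} → y ≢ + 0 → ∣ x ∣ ≤ ∣ y ∣ → ℚ.- ℚ.1ℚ ℚ.≤ ratio x y × ratio x y ℚ.≤ ℚ.1ℚ
-1≤ratio≤1 {x} {y} y≢0 ∣x∣≤∣y∣ =
  ℚₚ.toℚᵘ-cancel-≤ (ℚᵘₚ.≤-respʳ-≃ (ℚᵘₚ.≃-sym (toℚᵘ-ratio x y)) (proj₁ (bounds y y≢0 ∣x∣≤∣y∣))) ,
  ℚₚ.toℚᵘ-cancel-≤ (ℚᵘₚ.≤-respˡ-≃ (ℚᵘₚ.≃-sym (toℚᵘ-ratio x y)) (proj₂ (bounds y y≢0 ∣x∣≤∣y∣)))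
  where
  bounds-mkℚᵘ : ∀ n k → ∣ n ∣ ≤ suc k →
                ℚᵘ.- ℚᵘ.1ℚᵘ ℚᵘ.≤ ℚᵘ.mkℚᵘ n k × ℚᵘ.mkℚᵘ n k ℚᵘ.≤ ℚᵘ.1ℚᵘ
  bounds-mkℚᵘ n k ∣n∣≤1+k =
    ℚᵘ.*≤* (subst₂ ℤ._≤_ (sym (ℤₚ.-1*i≡-i (+ suc k))) (sym (ℤₚ.*-identityʳ n)) (proj₁ (∣i∣≤n⇒-n≤i≤n n ∣n∣≤1+k))) ,
    ℚᵘ.*≤* (subst₂ ℤ._≤_ (sym (ℤₚ.*-identityʳ n)) (sym (ℤₚ.*-identityˡ (+ suc k))) (proj₂ (∣i∣≤n⇒-n≤i≤n n ∣n∣≤1+k)))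
  bounds : ∀ y → y ≢ + 0 → ∣ x ∣ ≤ ∣ y ∣ →
           ℚᵘ.- ℚᵘ.1ℚᵘ ℚᵘ.≤ ratioᵘ x y × ratioᵘ x y ℚᵘ.≤ ℚᵘ.1ℚᵘ
  bounds (+ zero)  y≢0 _ = ⊥-elim (y≢0 refl)
  bounds (+ suc k) _ ∣x∣≤1+k = bounds-mkℚᵘ x k ∣x∣≤1+k
  bounds -[1+ k ]  _ ∣x∣≤1+k = bounds-mkℚᵘ (- x) k (subst (_≤ suc k) (sym (ℤₚ.∣-i∣≡∣i∣ x)) ∣x∣≤1+k)

p-ε≤p : ∀ p {ε} → ℚ.0ℚ ℚ.≤ ε → p ℚ.- ε ℚ.≤ p
p-ε≤p p {ε} 0≤ε = subst (p ℚ.- ε ℚ.≤_) (ℚₚ.+-identityʳ p) (ℚₚ.+-monoʳ-≤ p (ℚₚ.neg-antimono-≤ 0≤ε))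

p≤p+ε : ∀ p {ε} → ℚ.0ℚ ℚ.≤ ε → p ℚ.≤ p ℚ.+ ε
p≤p+ε p {ε} 0≤ε = subst (ℚ._≤ p ℚ.+ ε) (ℚₚ.+-identityʳ p) (ℚₚ.+-monoʳ-≤ p 0≤ε)

twice-1/[1+_]< : ∀ n l .(cop : Coprime (suc n) (suc l)) →
  1/[1+ 2 ℕ.* suc l ] ℚ.+ 1/[1+ 2 ℕ.* suc l ] ℚ.< mkℚ (+ suc n) l cop
twice-1/[1+_]< n l cop = ℚₚ.toℚᵘ-cancel-<
  (ℚᵘₚ.<-respˡ-≃ (ℚᵘₚ.≃-sym (ℚₚ.toℚᵘ-homo-+ 1/[1+ L ] 1/[1+ L ]))
    (ℚᵘ.*<* (subst₂ ℤ._<_ (sym lhs) (sym (ℤₚ.pos-* (suc n) (suc L ℕ.* suc L))) (ℤ.+<+ nat))))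
  where
  L = 2 ℕ.* suc l
  lhs : (+ 1 * + suc L + + 1 * + suc L) * + suc l ≡ + ((suc L ℕ.+ suc L) ℕ.* suc l)
  lhs = trans (cong (_* + suc l) (cong₂ _+_ (ℤₚ.*-identityˡ (+ suc L)) (ℤₚ.*-identityˡ (+ suc L))))
              (sym (ℤₚ.pos-* (suc L ℕ.+ suc L) (suc l)))
  expand : ∀ l → (suc (2 ℕ.* suc l) ℕ.+ suc (2 ℕ.* suc l)) ℕ.* suc l ≡ suc (2 ℕ.* suc l) ℕ.* (2 ℕ.* suc l)
  expand = ℕ-Solver.solve-∀
  nat : (suc L ℕ.+ suc L) ℕ.* suc l < suc n ℕ.* (suc L ℕ.* suc L)
  nat = begin-strict
    (suc L ℕ.+ suc L) ℕ.* suc l  ≡⟨ expand l ⟩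
    suc L ℕ.* L                  <⟨ ℕₚ.*-monoʳ-< (suc L) (ℕₚ.n<1+n L) ⟩
    suc L ℕ.* suc L              ≤⟨ ℕₚ.m≤n*m (suc L ℕ.* suc L) (suc n) ⟩
    suc n ℕ.* (suc L ℕ.* suc L)  ∎
    where open ℕₚ.≤-Reasoning

∣a/c-b/d∣≤1/[1+_] : ∀ {W M} L → Admissible W → W ∣ˡ M → suc L ≤ ∣ d W ∣ →
                     ℚ.∣ ratio (a M) (c M) ℚ.- ratio (b W) (d W) ∣ ℚ.≤ 1/[1+ L ]
∣a/c-b/d∣≤1/[1+_] {W} L admW (factor V admV refl) 1+L≤∣d∣ =
  ∣ratio-ratio∣≤1/[1+_] (c≢0 (admissible-⊗ admW admV)) (d≢0 admW) L (begin
    ∣ a M * d W - b W * c M ∣ ℕ.* suc L   ≡⟨ cong (ℕ._* suc L) ∣a′d-bc′∣≡∣a∣ ⟩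
    ∣ a V ∣ ℕ.* suc L                     ≤⟨ ℕₚ.*-mono-≤ (ℕₚ.≤-trans (Admissible.∣a∣≤∣c∣ admV) ∣c∣≤∣c′∣) 1+L≤∣d∣ ⟩
    ∣ c M ∣ ℕ.* ∣ d W ∣                   ∎)
  where
  open ℕₚ.≤-Reasoning
  M = W ⊗ V
  ∣c∣≤∣c′∣ : ∣ c V ∣ ≤ ∣ c M ∣
  ∣c∣≤∣c′∣ = ∣v∣≤∣x*u+y*v∣ {c W} {d W} (∣c∣<∣d∣ admW) (Admissible.∣a∣≤∣c∣ admV)
  identity : ∀ a b c d a′ c′ → (a * a′ + b * c′) * d - b * (c * a′ + d * c′) ≡ a′ * (a * d - b * c)
  identity = solve-∀
  ∣a′d-bc′∣≡∣a∣ : ∣ a M * d W - b W * c M ∣ ≡ ∣ a V ∣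
  ∣a′d-bc′∣≡∣a∣ = begin-equality
    ∣ a M * d W - b W * c M ∣   ≡⟨ cong ∣_∣ (identity (a W) (b W) (c W) (d W) (a V) (c V)) ⟩
    ∣ a V * det W ∣             ≡⟨ ℤₚ.∣i*j∣≡∣i∣*∣j∣ (a V) (det W) ⟩
    ∣ a V ∣ ℕ.* ∣ det W ∣       ≡⟨ cong (∣ a V ∣ ℕ.*_) (Admissible.∣det∣≡1 admW) ⟩
    ∣ a V ∣ ℕ.* 1               ≡⟨ ℕₚ.*-identityʳ ∣ a V ∣ ⟩
    ∣ a V ∣                     ∎

-- (e W , f W) is the row vector (s , - ν) W, so that e W / (s c W) = a W / c W - ν / s.
module Row (s ν : ℤ) where

  e f : Mat → ℤ
  e W = a W * s - ν * c W
  f W = b W * s - ν * d W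

  private
    row-⊗ : ∀ x y p q u v → (x * u + y * v) * s - ν * (p * u + q * v)
                          ≡ (x * s - ν * p) * u + (y * s - ν * q) * v
    row-⊗ x y p q u v = lemma x y p q u v s ν
      where
      lemma : ∀ x y p q u v s ν → (x * u + y * v) * s - ν * (p * u + q * v)
                                ≡ (x * s - ν * p) * u + (y * s - ν * q) * v
      lemma = solve-∀

  e-⊗ : ∀ W V → e (W ⊗ V) ≡ e W * a V + f W * c V
  e-⊗ W V = row-⊗ (a W) (b W) (c W) (d W) (a V) (c V)

  f-⊗ : ∀ W V → f (W ⊗ V) ≡ e W * b V + f W * d V
  f-⊗ W V = row-⊗ (a W) (b W) (c W) (d W) (b V) (d V)

  det*e : ∀ W V → det V * e W ≡ e (W ⊗ V) * d V - f (W ⊗ V) * c V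
  det*e W V = trans (lemma (e W) (f W) (a V) (b V) (c V) (d V))
                    (sym (cong₂ (λ p q → p * d V - q * c V) (e-⊗ W V) (f-⊗ W V)))
    where
    lemma : ∀ e f a b c d → (a * d - b * c) * e ≡ (e * a + f * c) * d - (e * b + f * d) * c
    lemma = solve-∀

  e*d-f*c : ∀ W → e W * d W - f W * c W ≡ s * det W
  e*d-f*c W = lemma (a W) (b W) (c W) (d W) s ν
    where
    lemma : ∀ a b c d s ν → (a * s - ν * c) * d - (b * s - ν * d) * c ≡ s * (a * d - b * c)
    lemma = solve-∀

  1≤∣e∣ : ∀ {W} → s ≢ + 0 → Admissible W → ∣ f W ∣ ≤ ∣ e W ∣ → 1 ≤ ∣ e W ∣
  1≤∣e∣ {W} s≢0 admW ∣f∣≤∣e∣ = ℕₚ.n≢0⇒n>0 λ ∣e∣≡0 →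
    let e≡0 = ℤₚ.∣i∣≡0⇒i≡0 {e W} ∣e∣≡0
        f≡0 = ℤₚ.∣i∣≡0⇒i≡0 {f W} (ℕₚ.n≤0⇒n≡0 (subst (∣ f W ∣ ≤_) ∣e∣≡0 ∣f∣≤∣e∣))
    in s≢0 (ℤₚ.∣i∣≡0⇒i≡0 {s} (begin
      ∣ s ∣                     ≡⟨ ℕₚ.*-identityʳ ∣ s ∣ ⟨
      ∣ s ∣ ℕ.* 1               ≡⟨ cong (∣ s ∣ ℕ.*_) (Admissible.∣det∣≡1 admW) ⟨
      ∣ s ∣ ℕ.* ∣ det W ∣       ≡⟨ ℤₚ.∣i*j∣≡∣i∣*∣j∣ s (det W) ⟨
      ∣ s * det W ∣             ≡⟨ cong ∣_∣ (e*d-f*c W) ⟨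
      ∣ e W * d W - f W * c W ∣ ≡⟨ cong₂ (λ p q → ∣ p * d W - q * c W ∣) e≡0 f≡0 ⟩
      0                         ∎))
    where open ≡-Reasoning

  ∣e∣<∣f∣⇒separated : ∀ W {V} → Admissible V → ∣ e W ∣ < ∣ f W ∣ →
    ∣ c (W ⊗ V) ∣ ℕ.* ∣ s ∣ ≤ ∣ e (W ⊗ V) ∣ ℕ.* ((∣ c W ∣ ℕ.+ ∣ d W ∣) ℕ.* ∣ s ∣)
  ∣e∣<∣f∣⇒separated W {V} admV ∣e∣<∣f∣ = begin
    ∣ c (W ⊗ V) ∣ ℕ.* ∣ s ∣        ≤⟨ ℕₚ.*-monoˡ-≤ ∣ s ∣ (∣c[W⊗V]∣≤ W admV) ⟩
    K ℕ.* ∣ c V ∣ ℕ.* ∣ s ∣        ≤⟨ ℕₚ.*-monoˡ-≤ ∣ s ∣ (ℕₚ.*-monoʳ-≤ K ∣c∣≤∣e[W⊗V]∣) ⟩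
    K ℕ.* ∣ e (W ⊗ V) ∣ ℕ.* ∣ s ∣  ≡⟨ rearrange K ∣ e (W ⊗ V) ∣ ∣ s ∣ ⟩
    ∣ e (W ⊗ V) ∣ ℕ.* (K ℕ.* ∣ s ∣) ∎
    where
    open ℕₚ.≤-Reasoning
    K = ∣ c W ∣ ℕ.+ ∣ d W ∣
    ∣c∣≤∣e[W⊗V]∣ : ∣ c V ∣ ≤ ∣ e (W ⊗ V) ∣
    ∣c∣≤∣e[W⊗V]∣ = subst (λ z → ∣ c V ∣ ≤ ∣ z ∣) (sym (e-⊗ W V))
                         (∣v∣≤∣x*u+y*v∣ {e W} {f W} ∣e∣<∣f∣ (Admissible.∣a∣≤∣c∣ admV))
    rearrange : ∀ k e s → k ℕ.* e ℕ.* s ≡ e ℕ.* (k ℕ.* s)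
    rearrange = ℕ-Solver.solve-∀

  ∣e[W⊗V]∣*∣d∣≤ : ∀ W {V} → Admissible V →
                  ∣ e (W ⊗ V) ∣ ℕ.* ∣ d V ∣ ≤ ∣ e W ∣ ℕ.+ ∣ f (W ⊗ V) ∣ ℕ.* ∣ c V ∣
  ∣e[W⊗V]∣*∣d∣≤ W {V} admV = begin
    ∣ e (W ⊗ V) ∣ ℕ.* ∣ d V ∣                              ≡⟨ ℤₚ.∣i*j∣≡∣i∣*∣j∣ (e (W ⊗ V)) (d V) ⟨
    ∣ e (W ⊗ V) * d V ∣                                    ≤⟨ ∣i∣≤∣i-j∣+∣j∣ (e (W ⊗ V) * d V) (f (W ⊗ V) * c V) ⟩
    ∣ e (W ⊗ V) * d V - f (W ⊗ V) * c V ∣ ℕ.+ ∣ f (W ⊗ V) * c V ∣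
                                                           ≡⟨ cong₂ ℕ._+_ ∣e′d-f′c∣≡∣e∣ (ℤₚ.∣i*j∣≡∣i∣*∣j∣ (f (W ⊗ V)) (c V)) ⟩
    ∣ e W ∣ ℕ.+ ∣ f (W ⊗ V) ∣ ℕ.* ∣ c V ∣                  ∎
    where
    open ℕₚ.≤-Reasoning
    ∣e′d-f′c∣≡∣e∣ : ∣ e (W ⊗ V) * d V - f (W ⊗ V) * c V ∣ ≡ ∣ e W ∣
    ∣e′d-f′c∣≡∣e∣ = begin-equality
      ∣ e (W ⊗ V) * d V - f (W ⊗ V) * c V ∣   ≡⟨ cong ∣_∣ (det*e W V) ⟨
      ∣ det V * e W ∣                         ≡⟨ ℤₚ.∣i*j∣≡∣i∣*∣j∣ (det V) (e W) ⟩
      ∣ det V ∣ ℕ.* ∣ e W ∣                   ≡⟨ cong (ℕ._* ∣ e W ∣) (Admissible.∣det∣≡1 admV) ⟩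
      1 ℕ.* ∣ e W ∣                           ≡⟨ ℕₚ.*-identityˡ ∣ e W ∣ ⟩
      ∣ e W ∣                                 ∎

  ∣e∣-descent : ∀ {W Y} → W ∣ˡ Y → ∣ f Y ∣ ≤ ∣ e Y ∣ → ∣ e Y ∣ ≤ ∣ e W ∣
  ∣e∣-descent {W} (factor V admV refl) ∣f∣≤∣e∣ = ℕₚ.+-cancelʳ-≤ (E′ ℕ.* C) E′ (∣ e W ∣) (begin
    E′ ℕ.+ E′ ℕ.* C               ≡⟨ ℕₚ.*-suc E′ C ⟨
    E′ ℕ.* suc C                  ≤⟨ ℕₚ.*-monoʳ-≤ E′ (∣c∣<∣d∣ admV) ⟩
    E′ ℕ.* ∣ d V ∣                ≤⟨ ∣e[W⊗V]∣*∣d∣≤ W admV ⟩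
    ∣ e W ∣ ℕ.+ ∣ f (W ⊗ V) ∣ ℕ.* C ≤⟨ ℕₚ.+-monoʳ-≤ ∣ e W ∣ (ℕₚ.*-monoˡ-≤ C ∣f∣≤∣e∣) ⟩
    ∣ e W ∣ ℕ.+ E′ ℕ.* C          ∎)
    where
    open ℕₚ.≤-Reasoning
    E′ = ∣ e (W ⊗ V) ∣
    C  = ∣ c V ∣

  ∣e∣-stationary : ∀ {W Y} (W∣Y : W ∣ˡ Y) → ∣ f Y ∣ ≤ ∣ e Y ∣ → 1 ≤ ∣ e Y ∣ → ∣ e Y ∣ ≡ ∣ e W ∣ →
                   ∣ f Y ∣ ≡ ∣ e Y ∣ × ∣ d (_∣ˡ_.cofactor W∣Y) ∣ ≡ suc ∣ c (_∣ˡ_.cofactor W∣Y) ∣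
  ∣e∣-stationary {W} (factor V admV refl) ∣f∣≤∣e∣ 1≤∣e∣ ∣e′∣≡∣e∣ =
    ℕₚ.≤-antisym ∣f∣≤∣e∣ (ℕₚ.*-cancelʳ-≤ E′ F′ C {{ℕ.>-nonZero (1≤∣c∣ admV)}} E′C≤F′C) ,
    ℕₚ.*-cancelˡ-≡ (∣ d V ∣) (suc C) E′ {{ℕ.>-nonZero 1≤∣e∣}} (ℕₚ.≤-antisym E′D≤E′[1+C] (ℕₚ.*-monoʳ-≤ E′ (∣c∣<∣d∣ admV)))
    where
    open ℕₚ.≤-Reasoning
    E′ = ∣ e (W ⊗ V) ∣
    F′ = ∣ f (W ⊗ V) ∣
    C  = ∣ c V ∣
    E′D≤E′+F′C : E′ ℕ.* ∣ d V ∣ ≤ E′ ℕ.+ F′ ℕ.* C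
    E′D≤E′+F′C = subst (λ z → E′ ℕ.* ∣ d V ∣ ≤ z ℕ.+ F′ ℕ.* C) (sym ∣e′∣≡∣e∣) (∣e[W⊗V]∣*∣d∣≤ W admV)
    E′D≤E′[1+C] : E′ ℕ.* ∣ d V ∣ ≤ E′ ℕ.* suc C
    E′D≤E′[1+C] = begin
      E′ ℕ.* ∣ d V ∣     ≤⟨ E′D≤E′+F′C ⟩
      E′ ℕ.+ F′ ℕ.* C    ≤⟨ ℕₚ.+-monoʳ-≤ E′ (ℕₚ.*-monoˡ-≤ C ∣f∣≤∣e∣) ⟩
      E′ ℕ.+ E′ ℕ.* C    ≡⟨ ℕₚ.*-suc E′ C ⟨
      E′ ℕ.* suc C       ∎
    E′C≤F′C : E′ ℕ.* C ≤ F′ ℕ.* C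
    E′C≤F′C = ℕₚ.+-cancelˡ-≤ E′ _ _ (begin
      E′ ℕ.+ E′ ℕ.* C    ≡⟨ ℕₚ.*-suc E′ C ⟨
      E′ ℕ.* suc C       ≤⟨ ℕₚ.*-monoʳ-≤ E′ (∣c∣<∣d∣ admV) ⟩
      E′ ℕ.* ∣ d V ∣     ≤⟨ E′D≤E′+F′C ⟩
      E′ ℕ.+ F′ ℕ.* C    ∎)

  exceptional-cofactor : ∀ {W Y} (W∣Y : W ∣ˡ Y) → 1 ≤ ∣ e W ∣ → ∣ f W ∣ ≡ ∣ e W ∣ →
    ∣ e Y ∣ ≡ ∣ e W ∣ → ∣ f Y ∣ ≡ ∣ e W ∣ → ∣ d (_∣ˡ_.cofactor W∣Y) ∣ ≡ suc ∣ c (_∣ˡ_.cofactor W∣Y) ∣ →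
    Exceptional (_∣ˡ_.cofactor W∣Y)
  exceptional-cofactor {W} (factor V admV refl) 1≤∣e∣ ∣f∣≡∣e∣ ∣e′∣≡∣e∣ ∣f′∣≡∣e∣ ∣d∣≡1+∣c∣ = exceptional {V}
    (∣εx+φy∣≡∣ε∣⇒1+∣x∣≡∣y∣ (e W) (f W) (a V) (c V) 1≤∣e∣ ∣f∣≡∣e∣ (Admissible.∣a∣≤∣c∣ admV)
                            (trans (cong ∣_∣ (sym (e-⊗ W V))) ∣e′∣≡∣e∣))
    (∣εx+φy∣≡∣ε∣⇒1+∣x∣≡∣y∣ (e W) (f W) (b V) (d V) 1≤∣e∣ ∣f∣≡∣e∣ (Admissible.∣b∣≤∣d∣ admV)
                            (trans (cong ∣_∣ (sym (f-⊗ W V))) ∣f′∣≡∣e∣))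
    ∣d∣≡1+∣c∣

module Continuants (P₁ P₂ : Mat) (q : ℕ → ℕ) (q≥1 : ∀ m → 1 ≤ q m)
                   (adm₁ : Admissible P₁) (adm₂ : Admissible P₂) where

  P : ℕ → Mat
  P = Pseq P₁ P₂ q

  admissible-P : ∀ n → Admissible (P n)
  admissible-P zero          = adm₁
  admissible-P (suc zero)    = adm₂
  admissible-P (suc (suc k)) = admissible-^⊗ (admissible-P (suc k)) (admissible-P k) (q k)

  P[1+k]∣ˡP[2+k] : ∀ k → P (suc k) ∣ˡ P (suc (suc k))
  P[1+k]∣ˡP[2+k] k with q k | q≥1 k
  ... | suc j | _ = factor (P (suc k) ^ᴹ j ⊗ P k)
                           (admissible-^⊗ (admissible-P (suc k)) (admissible-P k) j)
                           (⊗-assoc (P (suc k)) (P (suc k) ^ᴹ j) (P k))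

  P[1+k]∣ˡP[1+m] : ∀ {k m} → k < m → P (suc k) ∣ˡ P (suc m)
  P[1+k]∣ˡP[1+m] {k} {suc m} (s≤s k≤m) with ℕₚ.m≤n⇒m<n∨m≡n k≤m
  ... | inj₁ k<m  = ∣ˡ-trans (P[1+k]∣ˡP[1+m] k<m) (P[1+k]∣ˡP[2+k] m)
  ... | inj₂ refl = P[1+k]∣ˡP[2+k] k

  n<∣d[Pn]∣ : ∀ n → n < ∣ d (P n) ∣
  n<∣d[Pn]∣ zero          = ℕₚ.≤-trans (s≤s z≤n) (Admissible.2≤∣d∣ adm₁)
  n<∣d[Pn]∣ (suc zero)    = Admissible.2≤∣d∣ adm₂
  n<∣d[Pn]∣ (suc (suc k)) =
    ℕₚ.≤-<-trans (n<∣d[Pn]∣ (suc k)) (∣ˡ⇒∣d∣< (admissible-P (suc k)) (P[1+k]∣ˡP[2+k] k))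

  x : ℕ → ℚ
  x m = ratio (a (P m)) (c (P m))

  x-bounded : LimitIn[-1,1] x
  x-bounded ε ε>0 = 0 , λ m _ →
    let (-1≤x , x≤1) = -1≤ratio≤1 (c≢0 (admissible-P m)) (Admissible.∣a∣≤∣c∣ (admissible-P m))
    in ℚₚ.≤-trans (p-ε≤p (ℚ.- ℚ.1ℚ) (ℚₚ.<⇒≤ ε>0)) -1≤x , ℚₚ.≤-trans x≤1 (p≤p+ε ℚ.1ℚ (ℚₚ.<⇒≤ ε>0))

  x-near-b/d : ∀ {k m} → k < m →
               ℚ.∣ x (suc m) ℚ.- ratio (b (P (suc k))) (d (P (suc k))) ∣ ℚ.≤ 1/[1+ k ]
  x-near-b/d {k} k<m = ∣a/c-b/d∣≤1/[1+_] k (admissible-P (suc k)) (P[1+k]∣ˡP[1+m] k<m)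
                                         (ℕₚ.<⇒≤ (n<∣d[Pn]∣ (suc k)))

  x-cauchy : CauchySeq x
  x-cauchy (mkℚ (+ zero)  l _)   (ℚ.*<* (ℤ.+<+ ()))
  x-cauchy (mkℚ -[1+ _ ]  l _)   (ℚ.*<* ())
  x-cauchy (mkℚ (+ suc n) l cop) _ = suc (suc L) , close
    where
    L = 2 ℕ.* suc l
    y = ratio (b (P (suc L))) (d (P (suc L)))
    regroup : ∀ p q r → p ℚ.- q ≡ (p ℚ.- r) ℚ.- (q ℚ.- r)
    regroup = solve 3 (λ p q r → p :- q := (p :- r) :- (q :- r)) refl
      where open ℚ-Solver.+-*-Solver
    close : ∀ m m′ → suc (suc L) ≤ m → suc (suc L) ≤ m′ → ℚ.∣ x m ℚ.- x m′ ∣ ℚ.< mkℚ (+ suc n) l cop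
    close (suc m) (suc m′) (s≤s L<m) (s≤s L<m′) = ℚₚ.≤-<-trans (begin
      ℚ.∣ x (suc m) ℚ.- x (suc m′) ∣                         ≡⟨ cong ℚ.∣_∣ (regroup (x (suc m)) (x (suc m′)) y) ⟩
      ℚ.∣ (x (suc m) ℚ.- y) ℚ.- (x (suc m′) ℚ.- y) ∣          ≤⟨ ℚₚ.∣p-q∣≤∣p∣+∣q∣ (x (suc m) ℚ.- y) (x (suc m′) ℚ.- y) ⟩
      ℚ.∣ x (suc m) ℚ.- y ∣ ℚ.+ ℚ.∣ x (suc m′) ℚ.- y ∣       ≤⟨ ℚₚ.+-mono-≤ (x-near-b/d L<m) (x-near-b/d L<m′) ⟩
      1/[1+ L ] ℚ.+ 1/[1+ L ]                                ∎) (twice-1/[1+_]< n l cop)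
      where open ℚₚ.≤-Reasoning

  Recurrent : Mat → Set
  Recurrent W = ∀ N → Σ ℕ λ m → N ≤ m × W ∣ˡ P m

  recurrent-P : ∀ k → Recurrent (P (suc k))
  recurrent-P k N = suc (suc k ℕ.+ N)
                  , ℕₚ.≤-trans (ℕₚ.m≤n+m N (suc k)) (ℕₚ.n≤1+n _)
                  , P[1+k]∣ˡP[1+m] (ℕₚ.m≤m+n (suc k) N)

  recurrent-∣ˡ : ∀ {W M} → W ∣ˡ M → Recurrent M → Recurrent W
  recurrent-∣ˡ W∣M recM N = let (m , N≤m , M∣Pm) = recM N in m , N≤m , ∣ˡ-trans W∣M M∣Pm

  module _ (ν : ℤ) (den : ℕ) (x→ν/s : ConvergesTo x (ratio ν (+ suc den))) where
    open Row (+ suc den) ν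

    ∣f∣≤∣e∣ : ∀ {W} → Recurrent W → ∣ f W ∣ ≤ ∣ e W ∣
    ∣f∣≤∣e∣ {W} recW = ℕₚ.≮⇒≥ λ ∣e∣<∣f∣ →
      let (N , x≈ν/s)                  = x→ν/s 1/[1+ l ] (1/[1+_]>0 l)
          (m , N≤m , factor V admV Pm≡W⊗V) = recW N
          far  = subst (λ M → ∣ c M ∣ ℕ.* suc den ≤ ∣ e M ∣ ℕ.* l) (sym Pm≡W⊗V)
                       (∣e∣<∣f∣⇒separated W admV ∣e∣<∣f∣)
          near = ∣ratio-ratio∣<1/[1+_]⇒ {x′ = ν} (c≢0 (admissible-P m)) (λ ()) l (x≈ν/s m N≤m)
      in ℕₚ.<-irrefl refl (ℕₚ.<-≤-trans near (ℕₚ.≤-trans far (ℕₚ.*-monoʳ-≤ ∣ e (P m) ∣ (ℕₚ.n≤1+n l))))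
      where
      l = (∣ c W ∣ ℕ.+ ∣ d W ∣) ℕ.* suc den

    E : ℕ → ℕ
    E j = ∣ e (P (suc j)) ∣

    1≤E : ∀ j → 1 ≤ E j
    1≤E j = 1≤∣e∣ (λ ()) (admissible-P (suc j)) (∣f∣≤∣e∣ (recurrent-P j))

    E-antitone : ∀ {i k} → i ≤ k → E k ≤ E i
    E-antitone {i} {k} i≤k with ℕₚ.m≤n⇒m<n∨m≡n i≤k
    ... | inj₁ i<k  = ∣e∣-descent (P[1+k]∣ˡP[1+m] i<k) (∣f∣≤∣e∣ (recurrent-P k))
    ... | inj₂ refl = ℕₚ.≤-refl

    P[2+k]^q∣ˡP[3+k] : ∀ k → P (suc (suc k)) ^ᴹ q (suc k) ∣ˡ P (suc (suc (suc k)))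
    P[2+k]^q∣ˡP[3+k] k = factor (P (suc k)) (admissible-P (suc k)) refl

    ∣e∣-power-stationary : ∀ k → E k ≡ E (suc k) → E (suc k) ≡ E (suc (suc k)) →
      let W = P (suc (suc k)) ^ᴹ q (suc k) in ∣ e W ∣ ≡ E (suc k) × ∣ f W ∣ ≡ ∣ e W ∣
    ∣e∣-power-stationary k Ek≡Ek+1 Ek+1≡Ek+2
      with ^ᴹ-cases (admissible-P (suc (suc k))) (q≥1 (suc k))
    ... | inj₁ W≡Y = cong (λ M → ∣ e M ∣) W≡Y
                   , subst (λ M → ∣ f M ∣ ≡ ∣ e M ∣) (sym W≡Y)
                       (proj₁ (∣e∣-stationary (P[1+k]∣ˡP[2+k] k) (∣f∣≤∣e∣ (recurrent-P (suc k)))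
                                              (1≤E (suc k)) (sym Ek≡Ek+1)))
    ... | inj₂ Y∣W = ∣eW∣≡∣eY∣
                   , proj₁ (∣e∣-stationary Y∣W (∣f∣≤∣e∣ recW) (subst (1 ≤_) (sym ∣eW∣≡∣eY∣) (1≤E (suc k))) ∣eW∣≡∣eY∣)
      where
      W = P (suc (suc k)) ^ᴹ q (suc k)
      recW : Recurrent W
      recW = recurrent-∣ˡ (P[2+k]^q∣ˡP[3+k] k) (recurrent-P (suc (suc k)))
      ∣eW∣≡∣eY∣ : ∣ e W ∣ ≡ E (suc k)
      ∣eW∣≡∣eY∣ = ℕₚ.≤-antisym (∣e∣-descent Y∣W (∣f∣≤∣e∣ recW))
        (subst (_≤ ∣ e W ∣) (sym Ek+1≡Ek+2)
               (∣e∣-descent (P[2+k]^q∣ˡP[3+k] k) (∣f∣≤∣e∣ (recurrent-P (suc (suc k))))))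

    stationary⇒exceptional : ∀ k → E k ≡ E (suc k) → E (suc k) ≡ E (suc (suc k)) →
                             Exceptional (P (suc k))
    stationary⇒exceptional k Ek≡Ek+1 Ek+1≡Ek+2 =
      exceptional-cofactor (P[2+k]^q∣ˡP[3+k] k) 1≤∣eW∣ (proj₂ power)
                           ∣eP′∣≡∣eW∣ (trans (proj₁ P′-stationary) ∣eP′∣≡∣eW∣) (proj₂ P′-stationary)
      where
      W = P (suc (suc k)) ^ᴹ q (suc k)
      power : ∣ e W ∣ ≡ E (suc k) × ∣ f W ∣ ≡ ∣ e W ∣
      power = ∣e∣-power-stationary k Ek≡Ek+1 Ek+1≡Ek+2
      ∣eP′∣≡∣eW∣ : E (suc (suc k)) ≡ ∣ e W ∣
      ∣eP′∣≡∣eW∣ = trans (sym Ek+1≡Ek+2) (sym (proj₁ power))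
      1≤∣eW∣ : 1 ≤ ∣ e W ∣
      1≤∣eW∣ = subst (1 ≤_) ∣eP′∣≡∣eW∣ (1≤E (suc (suc k)))
      P′-stationary : ∣ f (P (suc (suc (suc k)))) ∣ ≡ E (suc (suc k)) × ∣ d (P (suc k)) ∣ ≡ suc ∣ c (P (suc k)) ∣
      P′-stationary = ∣e∣-stationary (P[2+k]^q∣ˡP[3+k] k) (∣f∣≤∣e∣ (recurrent-P (suc (suc k))))
                                     (1≤E (suc (suc k))) ∣eP′∣≡∣eW∣

    eventually-exceptional : ¬ ¬ (Σ ℕ λ N → ∀ m → N ≤ m → Exceptional (P m))
    eventually-exceptional never = antitone⇒¬¬stable E E-antitone λ (i , stable) →
      let step : ∀ {k} → i ≤ k → E k ≡ E (suc k)
          step {k} i≤k = trans (stable k i≤k) (sym (stable (suc k) (ℕₚ.m≤n⇒m≤1+n i≤k)))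
      in never (suc i , λ { (suc k) (s≤s i≤k) →
                              stationary⇒exceptional k (step i≤k) (step (ℕₚ.m≤n⇒m≤1+n i≤k)) })

  x-irrational : ¬ (Σ ℕ λ N → ∀ m → N ≤ m → Exceptional (P m)) → LimitIrrational x
  x-irrational never r@(mkℚ ν den _) x→r =
    eventually-exceptional ν den (subst (ConvergesTo x) (sym (ℚₚ.↥p/↧p≡p r)) x→r) never

lemma4p12 : (v : ℕ) → v ≥ 1 →
    (ε α : Fin v → ℤ) → (∀ i → IsSign (ε i)) →
    (w₁ w₂ : List (Fin v)) →
    Cond (evalWord ε α w₁) → Cond (evalWord ε α w₂) →
    (q : ℕ → ℕ) → (∀ m → 1 ≤ q m) →
    let P = Pseq (evalWord ε α w₁) (evalWord ε α w₂) q in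
    ¬ (Σ ℕ λ N → ∀ m → N ≤ m → Exceptional (P m)) →
    let x = λ m → ratio (a (P m)) (c (P m)) in
    (Σ ℕ λ N → ∀ m → N ≤ m → ¬ (c (P m) ≡ + 0))
    × CauchySeq x × LimitIn[-1,1] x × LimitIrrational x
lemma4p12 v _ ε α signs w₁ w₂ cond₁ cond₂ q q≥1 never =
  (0 , λ m _ → c≢0 (admissible-P m)) , x-cauchy , x-bounded , x-irrational never
  where
  open Continuants (evalWord ε α w₁) (evalWord ε α w₂) q q≥1
                   (fromCond cond₁ (∣det∣-evalWord ε α signs w₁))
                   (fromCond cond₂ (∣det∣-evalWord ε α signs w₂))
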